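{- Let $\lesssim$ be a plausible preorder on $\mathcal{T}$ and $E(\cdot|\cdot)$ the conditional expectation naturally induced by it. Let $X$ be a random quantity and $C,D$ events. Suppose $E(X.C|D)=0$ and there is a positive real number $p$ such that $p\lesssim_D C$. Then $E(X|C.D)=0$.
   Context: Random quantities: $\mathcal{T}$ is a unital associative commutative algebra over $\mathbb{R}$; reals $r$ are identified with $r\mathbf{1}$; products are written $X.Y$. Events: idempotents $A$ ($A.A=A$). Plausible preorder: a relation $\lesssim$ on $\mathcal{T}$ with (i) $0\lesssim A$ for every event $A$; (ii) $0\lesssim X$ and $0\lesssim Y$ imply $0\lesssim X+Y$; (iii) $0\lesssim X$ and real $q\ge0$ imply $0\lesssim qX$; (iv) $X\lesssim Y$ iff $0\lesssim Y-X$. Strict part: $X\lnsim Y$ iff $X\lesssim Y$ and not $Y\lesssim X$. Conditional preorder: $X\lesssim_C Y$ iff $X.C\lesssim Y.C$; strict part $\lnsim_C$. Expectation induced by a plausible preorder: $E(X)$ is the real $x$ if $-\epsilon\lnsim X-x\lnsim\epsilon$ for all reals $\epsilon>0$; it is $+\infty$ if $y\lnsim X$ for all reals $y$; it is $-\infty$ if $X\lnsim y$ for all reals $y$; it is undefined otherwise. Conditional expectation: $E(X|C)$ is the expectation induced by $\lesssim_C$. -}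

module Defs where

open import Data.Product using (Σ; _×_; _,_; ∃)
open import Data.Sum using (_⊎_)
open import Relation.Binary.PropositionalEquality using (_≡_; _≢_)
open import Relation.Nullary using (¬_)

-- The real numbers, axiomatised as a (Dedekind-)complete ordered field.
-- Any two such structures are isomorphic, so quantifying over an arbitrary
-- model `RealField` is the same as working with ℝ (agda-stdlib has no ℝ).
record RealField : Set₁ where
  infixl 6 _+_
  infixl 7 _*_
  infix  4 _<_ _≤_
  field
    R     : Set
    0r 1r : R
    _+_ _*_ : R → R → R
    -_    : R → R
    _<_   : R → R → Set
    +-assoc : ∀ x y z → (x + y) + z ≡ x + (y + z)
    +-comm  : ∀ x y → x + y ≡ y + x
    +-idˡ   : ∀ x → 0r + x ≡ x
    +-invˡ  : ∀ x → (- x) + x ≡ 0r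
    *-assoc : ∀ x y z → (x * y) * z ≡ x * (y * z)
    *-comm  : ∀ x y → x * y ≡ y * x
    *-idˡ   : ∀ x → 1r * x ≡ x
    distribˡ : ∀ x y z → x * (y + z) ≡ x * y + x * z
    0≢1     : 0r ≢ 1r
    inverse : ∀ x → x ≢ 0r → Σ R (λ y → x * y ≡ 1r)
    <-irrefl : ∀ x → ¬ (x < x)
    <-trans  : ∀ x y z → x < y → y < z → x < z
    <-trichotomy : ∀ x y → (x < y) ⊎ ((x ≡ y) ⊎ (y < x))
    +-mono-< : ∀ x y z → x < y → x + z < y + z
    *-pos    : ∀ x y → 0r < x → 0r < y → 0r < x * y
  _≤_ : R → R → Set
  x ≤ y = (x < y) ⊎ (x ≡ y)
  field
    complete : (P : R → Set) → Σ R P → Σ R (λ b → ∀ x → P x → x ≤ b) →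
               Σ R (λ s → (∀ x → P x → x ≤ s) ×
                          (∀ b → (∀ x → P x → x ≤ b) → s ≤ b))

record RAlgebra (ℝ : RealField) : Set₁ where
  open RealField ℝ using (R; 0r; 1r) renaming (_+_ to _+ᵣ_; _*_ to _*ᵣ_)
  infixl 6 _+_
  infixl 7 _∙_
  infixr 8 _·_
  field
    T     : Set
    𝟎 𝟏   : T
    _+_   : T → T → T
    _∙_   : T → T → T
    -ᵗ_   : T → T
    _·_   : R → T → T
    +-assoc : ∀ x y z → (x + y) + z ≡ x + (y + z)
    +-comm  : ∀ x y → x + y ≡ y + x
    +-idˡ   : ∀ x → 𝟎 + x ≡ x
    +-invˡ  : ∀ x → (-ᵗ x) + x ≡ 𝟎
    ∙-assoc : ∀ x y z → (x ∙ y) ∙ z ≡ x ∙ (y ∙ z)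
    ∙-comm  : ∀ x y → x ∙ y ≡ y ∙ x
    ∙-idˡ   : ∀ x → 𝟏 ∙ x ≡ x
    distribˡ : ∀ x y z → x ∙ (y + z) ≡ x ∙ y + x ∙ z
    ·-distribˡ : ∀ r x y → r · (x + y) ≡ r · x + r · y
    ·-distribʳ : ∀ r s x → (r +ᵣ s) · x ≡ r · x + s · x
    ·-assoc    : ∀ r s x → (r *ᵣ s) · x ≡ r · (s · x)
    ·-idˡ      : ∀ x → 1r · x ≡ x
    ·-∙        : ∀ r x y → (r · x) ∙ y ≡ r · (x ∙ y)
  ι : R → T
  ι r = r · 𝟏
  _-_ : T → T → T
  x - y = x + (-ᵗ y)
  IsEvent : T → Set
  IsEvent A = A ∙ A ≡ A

module _ {ℝ : RealField} (𝒯 : RAlgebra ℝ) where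
  open RealField ℝ using (R; 0r; _≤_; _<_) renaming (-_ to -ᵣ_)
  open RAlgebra 𝒯

  record IsPlausiblePreorder (_≲_ : T → T → Set) : Set where
    field
      event-nonneg : ∀ A → IsEvent A → 𝟎 ≲ A
      nonneg-+     : ∀ X Y → 𝟎 ≲ X → 𝟎 ≲ Y → 𝟎 ≲ (X + Y)
      nonneg-·     : ∀ X q → 𝟎 ≲ X → 0r ≤ q → 𝟎 ≲ (q · X)
      ≲⇔           : ∀ X Y → (X ≲ Y → 𝟎 ≲ (Y - X)) × (𝟎 ≲ (Y - X) → X ≲ Y)

  Strict : (T → T → Set) → T → T → Set
  Strict _≲_ X Y = (X ≲ Y) × ¬ (Y ≲ X)

  Cond : (T → T → Set) → T → T → T → Set
  Cond _≲_ C X Y = (X ∙ C) ≲ (Y ∙ C)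

  ExpectationIs : (T → T → Set) → T → R → Set
  ExpectationIs _≲_ X x =
    ∀ ε → 0r < ε → Strict _≲_ (ι (-ᵣ ε)) (X - ι x) × Strict _≲_ (X - ι x) (ι ε)

  CondExpectationIs : (T → T → Set) → T → T → R → Set
  CondExpectationIs _≲_ X C x = ExpectationIs (Cond _≲_ C) X x

-- On the event D, the hypothesis p ≲ C rescales the band -εp.D ⋦ X.C.D ⋦ εp.D into
-- -ε.C.D ≲ -εp.D and εp.D ≲ ε.C.D; a strict inequality followed by a weak one is
-- strict, so X.C.D lies strictly between -ε.C.D and ε.C.D for every ε > 0.
module Submission where

open import Defs
open import Algebra.Bundles using (CommutativeRing)
open import Algebra.Structures using (IsCommutativeRing)
open import Data.Product using (_×_; _,_; proj₁; proj₂)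
open import Data.Sum using (inj₁)
open import Function.Bundles using (_⇔_; mk⇔; Equivalence)
open import Relation.Binary.PropositionalEquality

module AlgebraProperties {ℝ : RealField} (𝒯 : RAlgebra ℝ) where
  open RealField ℝ using (0r) renaming (_*_ to _*ᵣ_; -_ to -ᵣ_)
  open RAlgebra 𝒯

  +-idʳ : ∀ x → x + 𝟎 ≡ x
  +-idʳ x = trans (+-comm x 𝟎) (+-idˡ x)

  ∙-idʳ : ∀ x → x ∙ 𝟏 ≡ x
  ∙-idʳ x = trans (∙-comm x 𝟏) (∙-idˡ x)

  distribʳ : ∀ x y z → (y + z) ∙ x ≡ y ∙ x + z ∙ x
  distribʳ x y z = trans (∙-comm (y + z) x)
    (trans (distribˡ x y z) (cong₂ _+_ (∙-comm x y) (∙-comm x z)))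

  isCommutativeRing : IsCommutativeRing _≡_ _+_ _∙_ -ᵗ_ 𝟎 𝟏
  isCommutativeRing = record
    { isRing = record
      { +-isAbelianGroup = record
        { isGroup = record
          { isMonoid = record
            { isSemigroup = record
              { isMagma = record { isEquivalence = isEquivalence ; ∙-cong = cong₂ _+_ }
              ; assoc = +-assoc }
            ; identity = +-idˡ , +-idʳ }
          ; inverse = +-invˡ , (λ x → trans (+-comm x (-ᵗ x)) (+-invˡ x))
          ; ⁻¹-cong = cong -ᵗ_ }
        ; comm = +-comm }
      ; *-cong = cong₂ _∙_
      ; *-assoc = ∙-assoc
      ; *-identity = ∙-idˡ , ∙-idʳ
      ; distrib = distribˡ , distribʳ }
    ; *-comm = ∙-comm }

  commutativeRing : CommutativeRing _ _
  commutativeRing = record { isCommutativeRing = isCommutativeRing }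

  open CommutativeRing commutativeRing using (ring; +-abelianGroup)
  open import Algebra.Properties.Ring ring public
    using (-‿distribˡ-*; x[y-z]≈xy-xz)
  open import Algebra.Properties.AbelianGroup +-abelianGroup
    using (identityˡ-unique; inverseˡ-unique; \\-leftDividesʳ; ε⁻¹≈ε; ⁻¹-∙-comm; ⁻¹-anti-homo‿-)

  ·≡ι∙ : ∀ r x → r · x ≡ ι r ∙ x
  ·≡ι∙ r x = sym (trans (·-∙ r 𝟏 x) (cong (r ·_) (∙-idˡ x)))

  ι-0 : ι 0r ≡ 𝟎
  ι-0 = identityˡ-unique (ι 0r) (ι 0r)
    (trans (sym (·-distribʳ 0r 0r 𝟏)) (cong (_· 𝟏) (RealField.+-idˡ ℝ 0r)))

  ι-neg : ∀ r → ι (-ᵣ r) ≡ -ᵗ ι r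
  ι-neg r = inverseˡ-unique (ι (-ᵣ r)) (ι r)
    (trans (sym (·-distribʳ (-ᵣ r) r 𝟏)) (trans (cong (_· 𝟏) (RealField.+-invˡ ℝ r)) ι-0))

  ι-*-∙ : ∀ r s x → ι (r *ᵣ s) ∙ x ≡ ι r ∙ (ι s ∙ x)
  ι-*-∙ r s x = trans (cong (_∙ x) (trans (·-assoc r s 𝟏) (·≡ι∙ r (ι s)))) (∙-assoc (ι r) (ι s) x)

  ι-neg-∙ : ∀ r x → ι (-ᵣ r) ∙ x ≡ -ᵗ (ι r ∙ x)
  ι-neg-∙ r x = trans (cong (_∙ x) (ι-neg r)) (sym (-‿distribˡ-* (ι r) x))

  -ι0-∙ : ∀ x y → (x - ι 0r) ∙ y ≡ x ∙ y
  -ι0-∙ x y = trans (cong (λ z → (x + z) ∙ y) (trans (cong -ᵗ_ ι-0) ε⁻¹≈ε)) (cong (_∙ y) (+-idʳ x))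

  [z-y]+[y-x]≡z-x : ∀ x y z → (z - y) + (y - x) ≡ z - x
  [z-y]+[y-x]≡z-x x y z = trans (+-assoc z (-ᵗ y) (y - x)) (cong (z +_) (\\-leftDividesʳ y (-ᵗ x)))

  [-x]-[-y]≡y-x : ∀ x y → (-ᵗ x) - (-ᵗ y) ≡ y - x
  [-x]-[-y]≡y-x x y = trans (⁻¹-∙-comm x (-ᵗ y)) (⁻¹-anti-homo‿- x y)

module PlausiblePreorderProperties {ℝ : RealField} (𝒯 : RAlgebra ℝ)
    {_≲_ : RAlgebra.T 𝒯 → RAlgebra.T 𝒯 → Set} (plausible : IsPlausiblePreorder 𝒯 _≲_) where
  open RealField ℝ using (R; 0r; _≤_; _<_)
  open RAlgebra 𝒯
  open IsPlausiblePreorder plausible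
  open AlgebraProperties 𝒯

  _⋦_ : T → T → Set
  _⋦_ = Strict 𝒯 _≲_

  ≲⇒nonneg : ∀ {x y} → x ≲ y → 𝟎 ≲ (y - x)
  ≲⇒nonneg {x} {y} = proj₁ (≲⇔ x y)

  nonneg⇒≲ : ∀ {x y} → 𝟎 ≲ (y - x) → x ≲ y
  nonneg⇒≲ {x} {y} = proj₂ (≲⇔ x y)

  ≲-trans : ∀ {x y z} → x ≲ y → y ≲ z → x ≲ z
  ≲-trans {x} {y} {z} x≲y y≲z = nonneg⇒≲ (subst (𝟎 ≲_) ([z-y]+[y-x]≡z-x x y z)
    (nonneg-+ (z - y) (y - x) (≲⇒nonneg y≲z) (≲⇒nonneg x≲y)))

  ⋦-≲-trans : ∀ {x y z} → x ⋦ y → y ≲ z → x ⋦ z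
  ⋦-≲-trans (x≲y , y≴x) y≲z = ≲-trans x≲y y≲z , λ z≲x → y≴x (≲-trans y≲z z≲x)

  ≲-⋦-trans : ∀ {x y z} → x ≲ y → y ⋦ z → x ⋦ z
  ≲-⋦-trans x≲y (y≲z , z≴y) = ≲-trans x≲y y≲z , λ z≲x → z≴y (≲-trans z≲x x≲y)

  neg-antitone : ∀ {x y} → x ≲ y → (-ᵗ y) ≲ (-ᵗ x)
  neg-antitone {x} {y} x≲y = nonneg⇒≲ (subst (𝟎 ≲_) (sym ([-x]-[-y]≡y-x x y)) (≲⇒nonneg x≲y))

  ι∙-mono : ∀ {q x y} → 0r ≤ q → x ≲ y → (ι q ∙ x) ≲ (ι q ∙ y)
  ι∙-mono {q} {x} {y} 0≤q x≲y = nonneg⇒≲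
    (subst (𝟎 ≲_) (trans (·≡ι∙ q (y - x)) (x[y-z]≈xy-xz (ι q) y x))
      (nonneg-· (y - x) q (≲⇒nonneg x≲y) 0≤q))

  StrictlyBounded : T → T → Set
  StrictlyBounded b y = (-ᵗ b) ⋦ y × y ⋦ b

  strictlyBounded-mono : ∀ {b b′ y} → b ≲ b′ → StrictlyBounded b y → StrictlyBounded b′ y
  strictlyBounded-mono b≲b′ (-b⋦y , y⋦b) = ≲-⋦-trans (neg-antitone b≲b′) -b⋦y , ⋦-≲-trans y⋦b b≲b′

  condExpectationIs-0⇔ : ∀ X D →
    CondExpectationIs 𝒯 _≲_ X D 0r ⇔ (∀ ε → 0r < ε → StrictlyBounded (ι ε ∙ D) (X ∙ D))
  condExpectationIs-0⇔ X D = mk⇔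
    (λ E≡0 ε ε>0 → subst₂ (bounds ε) (ι-neg-∙ ε D) (-ι0-∙ X D) (E≡0 ε ε>0))
    (λ bounded ε ε>0 → subst₂ (bounds ε) (sym (ι-neg-∙ ε D)) (sym (-ι0-∙ X D)) (bounded ε ε>0))
    where
    bounds : R → T → T → Set
    bounds ε a y = a ⋦ y × y ⋦ (ι ε ∙ D)

mainTheorem7 : (ℝ : RealField) (𝒯 : RAlgebra ℝ) (_≲_ : RAlgebra.T 𝒯 → RAlgebra.T 𝒯 → Set) →
    IsPlausiblePreorder 𝒯 _≲_ →
    (X C D : RAlgebra.T 𝒯) → RAlgebra.IsEvent 𝒯 C → RAlgebra.IsEvent 𝒯 D →
    CondExpectationIs 𝒯 _≲_ (RAlgebra._∙_ 𝒯 X C) D (RealField.0r ℝ) →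
    (p : RealField.R ℝ) → RealField._<_ ℝ (RealField.0r ℝ) p →
    Cond 𝒯 _≲_ D (RAlgebra.ι 𝒯 p) C →
    CondExpectationIs 𝒯 _≲_ X (RAlgebra._∙_ 𝒯 C D) (RealField.0r ℝ)
mainTheorem7 ℝ 𝒯 _≲_ plausible X C D _ _ E[XC|D]≡0 p p>0 p≲C =
  Equivalence.from (condExpectationIs-0⇔ X (C ∙ D)) λ ε ε>0 →
    strictlyBounded-mono (ι∙-mono (inj₁ ε>0) p≲C)
      (subst₂ StrictlyBounded (ι-*-∙ ε p D) (∙-assoc X C D)
        (Equivalence.to (condExpectationIs-0⇔ (X ∙ C) D) E[XC|D]≡0 (ε * p) (*-pos ε p ε>0 p>0)))
  where
  open RealField ℝ using (_*_; *-pos)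
  open RAlgebra 𝒯 using (_∙_; ∙-assoc)
  open AlgebraProperties 𝒯 using (ι-*-∙)
  open PlausiblePreorderProperties 𝒯 plausible
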